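{- Let $p$ be an odd prime, $m$ a positive integer, and for $k\geq 1$ let $$\mathbb R_k=\mathbb F_{p^m}[x_1,\dots,x_m]\big/\Big\langle \prod_{j=1}^m (x_j-1)^k\Big\rangle.$$ Then each invertible element of $\mathbb R_k$ has at most two distinct square roots in $\mathbb R_k$. -}

module Defs where

open import Level using (Level; _⊔_) renaming (suc to lsuc)
open import Algebra.Bundles using (CommutativeRing)
open import Data.Nat using (ℕ; zero; suc)
open import Data.Fin using (Fin; zero; suc)
open import Data.List using (List; []; _∷_; map)
open import Data.Product using (Σ; ∃; _×_; _,_)
open import Data.Sum using (_⊎_)
open import Relation.Nullary using (¬_)
open import Relation.Binary.PropositionalEquality using (_≡_)

record Field (c ℓ : Level) : Set (lsuc (c ⊔ ℓ)) where
  field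
    commutativeRing : CommutativeRing c ℓ
  open CommutativeRing commutativeRing public
  field
    1≉0     : ¬ (1# ≈ 0#)
    inverse : ∀ x → ¬ (x ≈ 0#) → ∃ λ y → (x * y) ≈ 1#

HasSize : ∀ {c ℓ} → Field c ℓ → ℕ → Set (c ⊔ ℓ)
HasSize F n = Σ (Fin n → Carrier) λ enum →
    (∀ i j → enum i ≈ enum j → i ≡ j) × (∀ x → ∃ λ i → enum i ≈ x)
  where open Field F

module Polynomials {c ℓ} (F : Field c ℓ) where
  open Field F using (Carrier; _≈_; _+_; _*_; -_; 0#; 1#)

  -- Poly (suc m) = univariate polynomials (coefficient lists, lowest degree first)
  -- in the variable x₀ with coefficients in Poly m (the variables x₁ …).
  -- Lists may have trailing zeros; equality ≈P below is coefficientwise.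
  data Poly : ℕ → Set c where
    const : Carrier → Poly zero
    poly  : ∀ {m} → List (Poly m) → Poly (suc m)

  zeroP : ∀ {m} → Poly m
  zeroP {zero}  = const 0#
  zeroP {suc m} = poly []

  oneP : ∀ {m} → Poly m
  oneP {zero}  = const 1#
  oneP {suc m} = poly (oneP ∷ [])

  addP : ∀ {m} → Poly m → Poly m → Poly m
  addL : ∀ {m} → List (Poly m) → List (Poly m) → List (Poly m)
  addP (const a) (const b) = const (a + b)
  addP (poly p) (poly q) = poly (addL p q)
  addL [] q = q
  addL (a ∷ p) [] = a ∷ p
  addL (a ∷ p) (b ∷ q) = addP a b ∷ addL p q

  negP : ∀ {m} → Poly m → Poly m
  negL : ∀ {m} → List (Poly m) → List (Poly m)
  negP (const a) = const (- a)
  negP (poly p) = poly (negL p)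
  negL [] = []
  negL (a ∷ p) = negP a ∷ negL p

  subP : ∀ {m} → Poly m → Poly m → Poly m
  subP p q = addP p (negP q)

  mulP : ∀ {m} → Poly m → Poly m → Poly m
  mulL : ∀ {m} → List (Poly m) → List (Poly m) → List (Poly m)
  mulP (const a) (const b) = const (a * b)
  mulP (poly p) (poly q) = poly (mulL p q)
  mulL [] q = []
  mulL (a ∷ p) q = addL (map (mulP a) q) (zeroP ∷ mulL p q)

  powP : ∀ {m} → Poly m → ℕ → Poly m
  powP p zero    = oneP
  powP p (suc k) = mulP p (powP p k)

  -- the variable x_j  (index 0 is the outermost variable)
  var : ∀ {m} → Fin m → Poly m
  var {suc m} zero    = poly (zeroP ∷ oneP ∷ [])
  var {suc m} (suc j) = poly (var j ∷ [])

  prodFin : ∀ {m n} → (Fin n → Poly m) → Poly m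
  prodFin {n = zero}  f = oneP
  prodFin {n = suc n} f = mulP (f zero) (prodFin (λ j → f (suc j)))

  lookupD : ∀ {m} → List (Poly m) → ℕ → Poly m
  lookupD []      _       = zeroP
  lookupD (a ∷ p) zero    = a
  lookupD (a ∷ p) (suc i) = lookupD p i

  coeff : ∀ {m} → Poly m → (Fin m → ℕ) → Carrier
  coeff (const a) _ = a
  coeff (poly p)  e = coeff (lookupD p (e zero)) (λ j → e (suc j))

  _≈P_ : ∀ {m} → Poly m → Poly m → Set ℓ
  p ≈P q = ∀ e → coeff p e ≈ coeff q e

  -- The ring R_k = F[x₁,…,x_m] / ⟨ ∏_j (x_j - 1)^k ⟩, with elements represented
  -- by polynomials and equality being congruence modulo the principal ideal.
  module Quotient (m k : ℕ) where
    gen : Poly m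
    gen = prodFin (λ j → powP (subP (var j) oneP) k)

    _≈R_ : Poly m → Poly m → Set (c ⊔ ℓ)
    a ≈R b = ∃ λ (h : Poly m) → subP a b ≈P mulP h gen

    IsUnit : Poly m → Set (c ⊔ ℓ)
    IsUnit u = ∃ λ (v : Poly m) → mulP u v ≈R oneP

    IsSqrtOf : Poly m → Poly m → Set (c ⊔ ℓ)
    IsSqrtOf r u = mulP r r ≈R u

    AtMostTwoSqrts : Poly m → Set (c ⊔ ℓ)
    AtMostTwoSqrts u = ∀ r₁ r₂ r₃ → IsSqrtOf r₁ u → IsSqrtOf r₂ u → IsSqrtOf r₃ u →
      (r₁ ≈R r₂) ⊎ (r₁ ≈R r₃) ⊎ (r₂ ≈R r₃)

module Submission where

-- In a commutative ring in which 2 is invertible and whose only idempotents are 0 and 1,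
-- square roots r, s of a unit u satisfy r = ±s: the elements r - s and r + s are orthogonal,
-- (r - s)(r + s) = r² - s² = 0, and add up to the unit 2r, so (r - s)(2r)⁻¹ is an idempotent.
-- Both hypotheses hold in R_k:
--   * 2 is invertible, since in characteristic 2 the map x ↦ x + 1 would be a fixed-point-free
--     involution of the odd-sized set F;
--   * R_k is connected: the substitution x_j := 1 kills the generator and maps an idempotent e
--     to an idempotent of the integral domain F[x₁ … x_m], i.e. to 0 or 1 (always the value of
--     e at (1, …, 1)).  If every such image is 0, the factor theorem gives e = ∏_j (x_j - 1) f,
--     so e = e^k lies in the ideal; otherwise apply this to 1 - e.

open import Defs
open import Level using (Level; _⊔_)
open import Algebra.Bundles using (CommutativeRing; AbelianGroup; RawRing)
open import Algebra.Structures using (IsAbelianGroup; IsCommutativeRing)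
open import Algebra.Morphism.Structures using (IsRingHomomorphism; IsRingMonomorphism)
import Algebra.Morphism.RingMonomorphism as RingMonomorphism
import Algebra.Morphism.Construct.Composition as Compose
import Algebra.Solver.Ring.NaturalCoefficients.Default as SemiringSolver
open import Data.Nat using (ℕ; zero; suc; _^_; _≥_; _%_; s≤s; z≤n)
open import Data.Nat.Primality using (Prime)
open import Data.Fin as Fin using (Fin; zero; suc)
import Data.Fin.Properties as Fin
open import Data.Fin.Permutation using (permutation)
open import Data.List using (List; []; _∷_; map)
open import Data.Product using (∃; _,_; proj₁; proj₂)
open import Data.Sum using (_⊎_; inj₁; inj₂) renaming (map to ⊎-map)
open import Relation.Nullary using (¬_; Dec; yes; no; does; contradiction)
open import Relation.Nullary.Decidable using (dec-true; dec-false)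
open import Relation.Binary.Definitions using (tri<; tri≈; tri>)
open import Relation.Binary.PropositionalEquality as ≡ using (_≡_; _≢_)

module Parity where
  open import Data.Nat using (_+_; _*_; _^_)
  import Data.Nat.Properties as ℕ
  open import Data.Nat.DivMod using (%-distribˡ-*; m*n%n≡0)
  open import Data.Bool using (if_then_else_)
  open import Algebra.Properties.CommutativeMonoid.Sum ℕ.+-0-commutativeMonoid
    using (sum; sum-cong-≗; ∑-distrib-+; sum-permute)
  open ≡ using (refl)
  open ≡.≡-Reasoning

  [_<_] : ∀ {n} → Fin n → Fin n → ℕ
  [ i < j ] = if does (i Fin.<? j) then 1 else 0

  [<]-exactly-one : ∀ {n} (i j : Fin n) → i ≢ j → [ i < j ] + [ j < i ] ≡ 1
  [<]-exactly-one i j i≢j with Fin.<-cmp i j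
  ... | tri< i<j _ j≮i rewrite dec-true (i Fin.<? j) i<j | dec-false (j Fin.<? i) j≮i = refl
  ... | tri≈ _ i≡j _ = contradiction i≡j i≢j
  ... | tri> i≮j _ j<i rewrite dec-false (i Fin.<? j) i≮j | dec-true (j Fin.<? i) j<i = refl

  sum-ones : ∀ n → sum {n} (λ _ → 1) ≡ n
  sum-ones zero    = refl
  sum-ones (suc n) = ≡.cong suc (sum-ones n)

  -- A fixed-point-free involution σ on Fin n pairs the elements up, so n is even:
  -- each pair {i, σ i} contributes 1 to the number of i with i < σ i.
  involution-even : ∀ n (σ : Fin n → Fin n) → (∀ i → σ (σ i) ≡ i) → (∀ i → σ i ≢ i) →
                    ∃ λ k → n ≡ k + k
  involution-even n σ σσ≡id σi≢i = sum lower , (begin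
      n                                     ≡⟨ ≡.sym (sum-ones n) ⟩
      sum {n} (λ _ → 1)                     ≡⟨ sum-cong-≗ {n} (λ i → ≡.sym (pair-count i)) ⟩
      sum (λ i → lower i + lower (σ i))     ≡⟨ ∑-distrib-+ lower (λ i → lower (σ i)) ⟩
      sum lower + sum (λ i → lower (σ i))
        ≡⟨ ≡.cong (sum lower +_) (≡.sym (sum-permute lower (permutation σ σ σσ≡id σσ≡id))) ⟩
      sum lower + sum lower                 ∎)
    where
      lower : Fin n → ℕ
      lower i = [ i < σ i ]
      pair-count : ∀ i → lower i + lower (σ i) ≡ 1
      pair-count i = ≡.subst (λ j → [ i < σ i ] + [ σ i < j ] ≡ 1) (≡.sym (σσ≡id i))
                       ([<]-exactly-one i (σ i) (λ e → σi≢i i (≡.sym e)))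

  odd-^ : ∀ p m → p % 2 ≡ 1 → p ^ m % 2 ≡ 1
  odd-^ p zero    _   = refl
  odd-^ p (suc m) odd = begin
    p * p ^ m % 2               ≡⟨ %-distribˡ-* p (p ^ m) 2 ⟩
    (p % 2) * (p ^ m % 2) % 2   ≡⟨ ≡.cong₂ (λ a b → a * b % 2) odd (odd-^ p m odd) ⟩
    1                           ∎

  even-not-odd : ∀ k → ¬ ((k + k) % 2 ≡ 1)
  even-not-odd k odd = contradiction (begin
      0                  ≡⟨ ≡.sym (m*n%n≡0 k 2) ⟩
      k * 2 % 2          ≡⟨ ≡.cong (_% 2) (ℕ.*-comm k 2) ⟩
      (k + (k + 0)) % 2  ≡⟨ ≡.cong (λ x → (k + x) % 2) (ℕ.+-identityʳ k) ⟩
      (k + k) % 2        ≡⟨ odd ⟩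
      1                  ∎) λ ()

module FieldProperties {c ℓ} (F : Field c ℓ) where
  open Field F
  open import Relation.Binary.Reasoning.Setoid setoid
  open import Algebra.Properties.Ring ring using (+-identityʳ-unique)

  no-zero-divisors : (∀ x → Dec (x ≈ 0#)) → ∀ x y → x * y ≈ 0# → x ≈ 0# ⊎ y ≈ 0#
  no-zero-divisors ≈0? x y xy≈0 with ≈0? x
  ... | yes x≈0 = inj₁ x≈0
  ... | no x≉0 with inverse x x≉0
  ... | x⁻¹ , xx⁻¹≈1 = inj₂ (begin
      y              ≈⟨ sym (*-identityˡ y) ⟩
      1# * y         ≈⟨ *-congʳ (sym xx⁻¹≈1) ⟩
      (x * x⁻¹) * y  ≈⟨ *-congʳ (*-comm x x⁻¹) ⟩
      (x⁻¹ * x) * y  ≈⟨ *-assoc x⁻¹ x y ⟩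
      x⁻¹ * (x * y)  ≈⟨ *-congˡ xy≈0 ⟩
      x⁻¹ * 0#       ≈⟨ zeroʳ x⁻¹ ⟩
      0#             ∎)

  module Finite {n} (size : HasSize F n) where
    enum : Fin n → Carrier
    enum = proj₁ size

    enum-injective : ∀ i j → enum i ≈ enum j → i ≡ j
    enum-injective = proj₁ (proj₂ size)

    index : Carrier → Fin n
    index x = proj₁ (proj₂ (proj₂ size) x)

    enum-index : ∀ x → enum (index x) ≈ x
    enum-index x = proj₂ (proj₂ (proj₂ size) x)

    ≈-dec : ∀ x y → Dec (x ≈ y)
    ≈-dec x y with index x Fin.≟ index y
    ... | yes ix≡iy = yes (trans (sym (enum-index x)) (trans (reflexive (≡.cong enum ix≡iy)) (enum-index y)))
    ... | no ix≢iy  = no λ x≈y → ix≢iy (enum-injective _ _ (trans (enum-index x) (trans x≈y (sym (enum-index y)))))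

    -- A field of odd order does not have characteristic 2: otherwise x ↦ x + 1 would be a
    -- fixed-point-free involution of the carrier, making n even.
    odd-order⇒2≉0 : n % 2 ≡ 1 → ¬ (1# + 1# ≈ 0#)
    odd-order⇒2≉0 odd 2≈0 with Parity.involution-even n σ σσ≡id σi≢i
      where
        σ : Fin n → Fin n
        σ i = index (enum i + 1#)
        σσ≡id : ∀ i → σ (σ i) ≡ i
        σσ≡id i = enum-injective (σ (σ i)) i (begin
          enum (σ (σ i))       ≈⟨ enum-index (enum (σ i) + 1#) ⟩
          enum (σ i) + 1#      ≈⟨ +-congʳ (enum-index (enum i + 1#)) ⟩
          (enum i + 1#) + 1#   ≈⟨ +-assoc (enum i) 1# 1# ⟩
          enum i + (1# + 1#)   ≈⟨ +-congˡ 2≈0 ⟩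
          enum i + 0#          ≈⟨ +-identityʳ (enum i) ⟩
          enum i               ∎)
        σi≢i : ∀ i → σ i ≢ i
        σi≢i i σi≡i = 1≉0 (+-identityʳ-unique (enum i) 1# (begin
          enum i + 1#   ≈⟨ sym (enum-index (enum i + 1#)) ⟩
          enum (σ i)    ≡⟨ ≡.cong enum σi≡i ⟩
          enum i        ∎))
    ... | k , n≡k+k = Parity.even-not-odd k (≡.subst (λ x → x % 2 ≡ 1) n≡k+k odd)

    half : n % 2 ≡ 1 → ∃ λ h → (1# + 1#) * h ≈ 1#
    half odd = inverse (1# + 1#) (odd-order⇒2≉0 odd)

module SquareRoots {a ℓ} (R : CommutativeRing a ℓ) where
  open CommutativeRing R
  open import Algebra.Properties.Ring ring
    using (+-identityʳ-unique; +-inverseˡ-unique; x∙y⁻¹≈ε⇒x≈y; -‿involutive; -0#≈0#; x[y-z]≈xy-xz; [y-z]x≈yx-zx)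
  open import Relation.Binary.Reasoning.Setoid setoid
  open SemiringSolver commutativeSemiring using (solve; _:+_; _:*_; _:=_)

  TrivialIdempotents : Set (a ⊔ ℓ)
  TrivialIdempotents = ∀ e → e * e ≈ e → e ≈ 0# ⊎ e ≈ 1#

  -- Without zero divisors, e (e - 1) = 0 forces e = 0 or e = 1.
  no-zero-divisors⇒trivial-idempotents : (∀ x y → x * y ≈ 0# → x ≈ 0# ⊎ y ≈ 0#) → TrivialIdempotents
  no-zero-divisors⇒trivial-idempotents no-zero-divisors e ee≈e with no-zero-divisors e (e - 1#) (begin
      e * (e - 1#)          ≈⟨ x[y-z]≈xy-xz e e 1# ⟩
      e * e - e * 1#        ≈⟨ +-cong ee≈e (-‿cong (*-identityʳ e)) ⟩
      e - e                 ≈⟨ -‿inverseʳ e ⟩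
      0#                    ∎)
  ... | inj₁ e≈0   = inj₁ e≈0
  ... | inj₂ e-1≈0 = inj₂ (x∙y⁻¹≈ε⇒x≈y e 1# e-1≈0)

  complement-idempotent : ∀ e → e * e ≈ e → (1# - e) * (1# - e) ≈ 1# - e
  complement-idempotent e ee≈e = begin
    (1# - e) * (1# - e)             ≈⟨ [y-z]x≈yx-zx (1# - e) 1# e ⟩
    1# * (1# - e) - e * (1# - e)    ≈⟨ +-cong (*-identityˡ (1# - e)) (-‿cong (x[y-z]≈xy-xz e 1# e)) ⟩
    (1# - e) - (e * 1# - e * e)     ≈⟨ +-congˡ (-‿cong (trans (+-cong (*-identityʳ e) (-‿cong ee≈e)) (-‿inverseʳ e))) ⟩
    (1# - e) - 0#                   ≈⟨ trans (+-congˡ -0#≈0#) (+-identityʳ (1# - e)) ⟩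
    1# - e                          ∎

  -- If a b = 0 and a + b is a unit with inverse w, then e = a w is idempotent (its
  -- complement is b w); so in a connected ring one of a, b vanishes.
  orthogonal-unit-sum : TrivialIdempotents → ∀ a b w → a * b ≈ 0# → (a + b) * w ≈ 1# →
                        a ≈ 0# ⊎ b ≈ 0#
  orthogonal-unit-sum trivial a b w ab≈0 [a+b]w≈1 with trivial (a * w) idempotent
    where
      split : a * w + b * w ≈ 1#
      split = trans (sym (distribʳ w a b)) [a+b]w≈1
      orthogonal : (a * w) * (b * w) ≈ 0#
      orthogonal = begin
        (a * w) * (b * w)  ≈⟨ solve 3 (λ a b w → (a :* w) :* (b :* w) := (a :* b) :* (w :* w)) refl a b w ⟩
        (a * b) * (w * w)  ≈⟨ *-congʳ ab≈0 ⟩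
        0# * (w * w)       ≈⟨ zeroˡ (w * w) ⟩
        0#                 ∎
      idempotent : (a * w) * (a * w) ≈ a * w
      idempotent = begin
        (a * w) * (a * w)                      ≈⟨ sym (+-identityʳ _) ⟩
        (a * w) * (a * w) + 0#                 ≈⟨ +-congˡ (sym orthogonal) ⟩
        (a * w) * (a * w) + (a * w) * (b * w)  ≈⟨ sym (distribˡ (a * w) (a * w) (b * w)) ⟩
        (a * w) * (a * w + b * w)              ≈⟨ *-congˡ split ⟩
        (a * w) * 1#                           ≈⟨ *-identityʳ (a * w) ⟩
        a * w                                  ∎
  ... | inj₁ aw≈0 = inj₁ (begin
      a                             ≈⟨ sym (*-identityʳ a) ⟩
      a * 1#                        ≈⟨ *-congˡ (sym [a+b]w≈1) ⟩
      a * ((a + b) * w)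
        ≈⟨ solve 3 (λ a b w → a :* ((a :+ b) :* w) := (a :* w) :* a :+ (a :* b) :* w) refl a b w ⟩
      (a * w) * a + (a * b) * w     ≈⟨ +-cong (*-congʳ aw≈0) (*-congʳ ab≈0) ⟩
      0# * a + 0# * w               ≈⟨ +-cong (zeroˡ a) (zeroˡ w) ⟩
      0# + 0#                       ≈⟨ +-identityʳ 0# ⟩
      0#                            ∎)
  ... | inj₂ aw≈1 = inj₂ (begin
      b                             ≈⟨ sym (*-identityʳ b) ⟩
      b * 1#                        ≈⟨ *-congˡ (sym [a+b]w≈1) ⟩
      b * ((a + b) * w)
        ≈⟨ solve 3 (λ a b w → b :* ((a :+ b) :* w) := (a :* b) :* w :+ (b :* w) :* b) refl a b w ⟩
      (a * b) * w + (b * w) * b     ≈⟨ +-cong (*-congʳ ab≈0) (*-congʳ bw≈0) ⟩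
      0# * w + 0# * b               ≈⟨ +-cong (zeroˡ w) (zeroˡ b) ⟩
      0# + 0#                       ≈⟨ +-identityʳ 0# ⟩
      0#                            ∎)
    where
      bw≈0 : b * w ≈ 0#
      bw≈0 = +-identityʳ-unique 1# (b * w)
        (trans (+-congʳ (sym aw≈1)) (trans (sym (distribʳ w a b)) [a+b]w≈1))

  module _ (trivial : TrivialIdempotents) (h : Carrier) (2h≈1 : (1# + 1#) * h ≈ 1#) where

    square-roots-of-unit : ∀ u v r s → u * v ≈ 1# → r * r ≈ u → s * s ≈ u → r ≈ s ⊎ r ≈ - s
    square-roots-of-unit u v r s uv≈1 r²≈u s²≈u
      with orthogonal-unit-sum trivial (r - s) (r + s) (h * (r * v)) product≈0 sum-invertible
      where
        s-s≈0 : s - s ≈ 0#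
        s-s≈0 = -‿inverseʳ s
        product≈0 : (r - s) * (r + s) ≈ 0#
        product≈0 = begin
          (r - s) * (r + s)
            ≈⟨ solve 3 (λ r n s → (r :+ n) :* (r :+ s) := r :* r :+ (n :* s :+ r :* (s :+ n))) refl r (- s) s ⟩
          r * r + (- s * s + r * (s - s))     ≈⟨ +-cong (trans r²≈u (sym s²≈u)) (+-congˡ (*-congˡ s-s≈0)) ⟩
          s * s + (- s * s + r * 0#)          ≈⟨ +-congˡ (trans (+-congˡ (zeroʳ r)) (+-identityʳ _)) ⟩
          s * s + - s * s                     ≈⟨ sym (distribʳ s s (- s)) ⟩
          (s - s) * s                         ≈⟨ *-congʳ s-s≈0 ⟩
          0# * s                              ≈⟨ zeroˡ s ⟩
          0#                                  ∎
        -- (r - s) + (r + s) = 2r, whose inverse is h r v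
        sum-invertible : ((r - s) + (r + s)) * (h * (r * v)) ≈ 1#
        sum-invertible = begin
          ((r - s) + (r + s)) * (h * (r * v))
            ≈⟨ *-congʳ (solve 3 (λ r n s → (r :+ n) :+ (r :+ s) := (r :+ r) :+ (s :+ n)) refl r (- s) s) ⟩
          ((r + r) + (s - s)) * (h * (r * v))   ≈⟨ *-congʳ (trans (+-congˡ s-s≈0) (+-identityʳ (r + r))) ⟩
          (r + r) * (h * (r * v))
            ≈⟨ solve 3 (λ r h v → (r :+ r) :* (h :* (r :* v)) := (h :+ h) :* ((r :* r) :* v)) refl r h v ⟩
          (h + h) * ((r * r) * v)
            ≈⟨ *-cong (sym (trans (distribʳ h 1# 1#) (+-cong (*-identityˡ h) (*-identityˡ h)))) (*-congʳ r²≈u) ⟩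
          ((1# + 1#) * h) * (u * v)             ≈⟨ *-cong 2h≈1 uv≈1 ⟩
          1# * 1#                               ≈⟨ *-identityˡ 1# ⟩
          1#                                    ∎
    ... | inj₁ r-s≈0 = inj₁ (x∙y⁻¹≈ε⇒x≈y r s r-s≈0)
    ... | inj₂ r+s≈0 = inj₂ (+-inverseˡ-unique r s r+s≈0)

    at-most-two-square-roots : ∀ u v r₁ r₂ r₃ → u * v ≈ 1# → r₁ * r₁ ≈ u → r₂ * r₂ ≈ u → r₃ * r₃ ≈ u →
                               r₁ ≈ r₂ ⊎ r₁ ≈ r₃ ⊎ r₂ ≈ r₃
    at-most-two-square-roots u v r₁ r₂ r₃ uv≈1 r₁²≈u r₂²≈u r₃²≈u
      with square-roots-of-unit u v r₁ r₂ uv≈1 r₁²≈u r₂²≈u | square-roots-of-unit u v r₁ r₃ uv≈1 r₁²≈u r₃²≈u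
    ... | inj₁ r₁≈r₂   | _            = inj₁ r₁≈r₂
    ... | inj₂ _       | inj₁ r₁≈r₃   = inj₂ (inj₁ r₁≈r₃)
    ... | inj₂ r₁≈-r₂  | inj₂ r₁≈-r₃  = inj₂ (inj₂ (begin
      r₂        ≈⟨ sym (-‿involutive r₂) ⟩
      - (- r₂)  ≈⟨ -‿cong (sym r₁≈-r₂) ⟩
      - r₁      ≈⟨ -‿cong r₁≈-r₃ ⟩
      - (- r₃)  ≈⟨ -‿involutive r₃ ⟩
      r₃        ∎))

module PrincipalQuotient {a ℓ} (R : CommutativeRing a ℓ) (g : CommutativeRing.Carrier R) where
  open CommutativeRing R
  open import Algebra.Properties.Ring ring using (-‿distribˡ-*; -‿+-comm; -0#≈0#)
  open import Relation.Binary.Reasoning.Setoid setoid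
  open SemiringSolver commutativeSemiring using (solve; _:+_; _:*_; _:=_)

  infix 4 _≈Q_
  _≈Q_ : Carrier → Carrier → Set (a ⊔ ℓ)
  x ≈Q y = ∃ λ h → x - y ≈ h * g

  difference⇒sum : ∀ {x y h} → x - y ≈ h * g → x ≈ y + h * g
  difference⇒sum {x} {y} {h} x-y≈hg = begin
    x               ≈⟨ sym (+-identityʳ x) ⟩
    x + 0#          ≈⟨ +-congˡ (sym (-‿inverseˡ y)) ⟩
    x + (- y + y)   ≈⟨ sym (+-assoc x (- y) y) ⟩
    (x - y) + y     ≈⟨ +-congʳ x-y≈hg ⟩
    h * g + y       ≈⟨ +-comm (h * g) y ⟩
    y + h * g       ∎

  sum⇒difference : ∀ {x y h} → x ≈ y + h * g → x - y ≈ h * g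
  sum⇒difference {x} {y} {h} x≈y+hg = begin
    x - y              ≈⟨ +-congʳ (trans x≈y+hg (+-comm y (h * g))) ⟩
    (h * g + y) - y    ≈⟨ +-assoc (h * g) y (- y) ⟩
    h * g + (y - y)    ≈⟨ +-congˡ (-‿inverseʳ y) ⟩
    h * g + 0#         ≈⟨ +-identityʳ (h * g) ⟩
    h * g              ∎

  ≈⇒≈Q : ∀ {x y} → x ≈ y → x ≈Q y
  ≈⇒≈Q {x} {y} x≈y = 0# , trans (+-congʳ x≈y) (trans (-‿inverseʳ y) (sym (zeroˡ g)))

  multiple≈Q0 : ∀ h → h * g ≈Q 0#
  multiple≈Q0 h = h , trans (+-congˡ -0#≈0#) (+-identityʳ (h * g))

  ≈Q-sym : ∀ {x y} → x ≈Q y → y ≈Q x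
  ≈Q-sym {x} {y} (h , x-y≈hg) = - h , sum⇒difference (begin
    y                          ≈⟨ sym (+-identityʳ y) ⟩
    y + 0#                     ≈⟨ +-congˡ (sym (trans (+-congˡ (sym (-‿distribˡ-* h g))) (-‿inverseʳ (h * g)))) ⟩
    y + (h * g + - h * g)      ≈⟨ sym (+-assoc y (h * g) (- h * g)) ⟩
    (y + h * g) + - h * g      ≈⟨ +-congʳ (sym (difference⇒sum x-y≈hg)) ⟩
    x + - h * g                ∎)

  ≈Q-trans : ∀ {x y z} → x ≈Q y → y ≈Q z → x ≈Q z
  ≈Q-trans {x} {y} {z} (h₁ , x-y≈h₁g) (h₂ , y-z≈h₂g) = h₂ + h₁ , sum⇒difference (begin
    x                          ≈⟨ difference⇒sum x-y≈h₁g ⟩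
    y + h₁ * g                 ≈⟨ +-congʳ (difference⇒sum y-z≈h₂g) ⟩
    (z + h₂ * g) + h₁ * g      ≈⟨ solve 4 (λ z h₂ g h₁ → (z :+ h₂ :* g) :+ h₁ :* g := z :+ (h₂ :+ h₁) :* g) refl z h₂ g h₁ ⟩
    z + (h₂ + h₁) * g          ∎)

  +-congQ : ∀ {x x' y y'} → x ≈Q x' → y ≈Q y' → x + y ≈Q x' + y'
  +-congQ {x} {x'} {y} {y'} (h₁ , e₁) (h₂ , e₂) = h₁ + h₂ , sum⇒difference (begin
    x + y                              ≈⟨ +-cong (difference⇒sum e₁) (difference⇒sum e₂) ⟩
    (x' + h₁ * g) + (y' + h₂ * g)
      ≈⟨ solve 5 (λ x' h₁ g y' h₂ → (x' :+ h₁ :* g) :+ (y' :+ h₂ :* g) := (x' :+ y') :+ (h₁ :+ h₂) :* g)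
                 refl x' h₁ g y' h₂ ⟩
    (x' + y') + (h₁ + h₂) * g          ∎)

  *-congQ : ∀ {x x' y y'} → x ≈Q x' → y ≈Q y' → x * y ≈Q x' * y'
  *-congQ {x} {x'} {y} {y'} (h₁ , e₁) (h₂ , e₂) = h₁ * y' + x' * h₂ + h₁ * g * h₂ , sum⇒difference (begin
    x * y                              ≈⟨ *-cong (difference⇒sum e₁) (difference⇒sum e₂) ⟩
    (x' + h₁ * g) * (y' + h₂ * g)
      ≈⟨ solve 5 (λ x' h₁ g y' h₂ → (x' :+ h₁ :* g) :* (y' :+ h₂ :* g)
                                  := x' :* y' :+ (h₁ :* y' :+ x' :* h₂ :+ h₁ :* g :* h₂) :* g)
                 refl x' h₁ g y' h₂ ⟩
    x' * y' + (h₁ * y' + x' * h₂ + h₁ * g * h₂) * g ∎)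

  -‿congQ : ∀ {x x'} → x ≈Q x' → - x ≈Q - x'
  -‿congQ {x} {x'} (h , e) = - h , sum⇒difference (begin
    - x                   ≈⟨ -‿cong (difference⇒sum e) ⟩
    - (x' + h * g)        ≈⟨ sym (-‿+-comm x' (h * g)) ⟩
    - x' + - (h * g)      ≈⟨ +-congˡ (-‿distribˡ-* h g) ⟩
    - x' + - h * g        ∎)

  R/⟨g⟩ : CommutativeRing a (a ⊔ ℓ)
  R/⟨g⟩ = record
    { Carrier = Carrier ; _≈_ = _≈Q_ ; _+_ = _+_ ; _*_ = _*_ ; -_ = -_ ; 0# = 0# ; 1# = 1#
    ; isCommutativeRing = record
      { isRing = record
        { +-isAbelianGroup = record
          { isGroup = record
            { isMonoid = record
              { isSemigroup = record
                { isMagma = record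
                  { isEquivalence = record { refl = ≈⇒≈Q refl ; sym = ≈Q-sym ; trans = ≈Q-trans }
                  ; ∙-cong = +-congQ }
                ; assoc = λ x y z → ≈⇒≈Q (+-assoc x y z) }
              ; identity = (λ x → ≈⇒≈Q (+-identityˡ x)) , (λ x → ≈⇒≈Q (+-identityʳ x)) }
            ; inverse = (λ x → ≈⇒≈Q (-‿inverseˡ x)) , (λ x → ≈⇒≈Q (-‿inverseʳ x))
            ; ⁻¹-cong = -‿congQ }
          ; comm = λ x y → ≈⇒≈Q (+-comm x y) }
        ; *-cong = *-congQ
        ; *-assoc = λ x y z → ≈⇒≈Q (*-assoc x y z)
        ; *-identity = (λ x → ≈⇒≈Q (*-identityˡ x)) , (λ x → ≈⇒≈Q (*-identityʳ x))
        ; distrib = (λ x y z → ≈⇒≈Q (distribˡ x y z)) , (λ x y z → ≈⇒≈Q (distribʳ x y z)) }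
      ; *-comm = λ x y → ≈⇒≈Q (*-comm x y) } }

module _ {a b ℓ₁ ℓ₂} {R : RawRing a ℓ₁} {S : RawRing b ℓ₂} where
  private
    module R = RawRing R
    module S = RawRing S

  ring-homomorphism : {f : R.Carrier → S.Carrier} →
    (∀ {x y} → x R.≈ y → f x S.≈ f y) →
    (∀ x y → f (x R.+ y) S.≈ f x S.+ f y) →
    (∀ x y → f (x R.* y) S.≈ f x S.* f y) →
    (∀ x → f (R.- x) S.≈ S.- f x) →
    f R.0# S.≈ S.0# →
    f R.1# S.≈ S.1# →
    IsRingHomomorphism R S f
  ring-homomorphism f-cong +-homo *-homo -‿homo 0#-homo 1#-homo = record
    { isSemiringHomomorphism = record
      { isNearSemiringHomomorphism = record
        { +-isMonoidHomomorphism = record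
          { isMagmaHomomorphism = record
            { isRelHomomorphism = record { cong = f-cong }
            ; homo = +-homo }
          ; ε-homo = 0#-homo }
        ; *-homo = *-homo }
      ; 1#-homo = 1#-homo }
    ; -‿homo = -‿homo }

-- Univariate polynomials over a commutative ring R, represented by coefficient lists
-- (lowest degree first) and compared coefficientwise, so trailing zeros do not matter.
module Univariate {a ℓ} (R : CommutativeRing a ℓ) where
  open CommutativeRing R renaming (Carrier to A) hiding (zero)
  open import Algebra.Properties.Ring ring using (-0#≈0#; -‿+-comm)

  coeff : List A → ℕ → A
  coeff []      _       = 0#
  coeff (x ∷ p) zero    = x
  coeff (x ∷ p) (suc i) = coeff p i

  addL : List A → List A → List A
  addL []      q       = q
  addL (x ∷ p) []      = x ∷ p
  addL (x ∷ p) (y ∷ q) = (x + y) ∷ addL p q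

  negL : List A → List A
  negL []      = []
  negL (x ∷ p) = (- x) ∷ negL p

  scale : A → List A → List A
  scale x = map (x *_)

  mulL : List A → List A → List A
  mulL []      q = []
  mulL (x ∷ p) q = addL (scale x q) (0# ∷ mulL p q)

  infix 4 _≈L_
  record _≈L_ (p q : List A) : Set ℓ where
    constructor mk
    field get : ∀ i → coeff p i ≈ coeff q i
  open _≈L_ public

  ≈L-refl : ∀ {p} → p ≈L p
  ≈L-refl = mk λ i → refl

  ≈L-sym : ∀ {p q} → p ≈L q → q ≈L p
  ≈L-sym (mk p≈q) = mk λ i → sym (p≈q i)

  ≈L-trans : ∀ {p q r} → p ≈L q → q ≈L r → p ≈L r
  ≈L-trans (mk p≈q) (mk q≈r) = mk λ i → trans (p≈q i) (q≈r i)

  module ≈L-Reasoning where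
    open import Relation.Binary.Bundles using (Setoid)
    ≈L-setoid : Setoid a ℓ
    ≈L-setoid = record
      { Carrier = List A ; _≈_ = _≈L_
      ; isEquivalence = record { refl = ≈L-refl ; sym = ≈L-sym ; trans = ≈L-trans } }
    open import Relation.Binary.Reasoning.Setoid ≈L-setoid public

  ∷-cong : ∀ {x y p q} → x ≈ y → p ≈L q → (x ∷ p) ≈L (y ∷ q)
  ∷-cong x≈y (mk p≈q) = mk λ { zero → x≈y ; (suc i) → p≈q i }

  ∷-tail : ∀ {x y p q} → (x ∷ p) ≈L (y ∷ q) → p ≈L q
  ∷-tail (mk h) = mk λ i → h (suc i)

  ∷-zero : ∀ {x p} → x ≈ 0# → p ≈L [] → (x ∷ p) ≈L []
  ∷-zero x≈0 (mk p≈0) = mk λ { zero → x≈0 ; (suc i) → p≈0 i }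

  ∷-zero-tail : ∀ {x p} → (x ∷ p) ≈L [] → p ≈L []
  ∷-zero-tail (mk h) = mk λ i → h (suc i)

  coeff-add : ∀ p q i → coeff (addL p q) i ≈ coeff p i + coeff q i
  coeff-add []      q       i       = sym (+-identityˡ _)
  coeff-add (x ∷ p) []      i       = sym (+-identityʳ _)
  coeff-add (x ∷ p) (y ∷ q) zero    = refl
  coeff-add (x ∷ p) (y ∷ q) (suc i) = coeff-add p q i

  coeff-neg : ∀ p i → coeff (negL p) i ≈ - coeff p i
  coeff-neg []      i       = sym -0#≈0#
  coeff-neg (x ∷ p) zero    = refl
  coeff-neg (x ∷ p) (suc i) = coeff-neg p i

  coeff-scale : ∀ x p i → coeff (scale x p) i ≈ x * coeff p i
  coeff-scale x []      i       = sym (zeroʳ x)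
  coeff-scale x (y ∷ p) zero    = refl
  coeff-scale x (y ∷ p) (suc i) = coeff-scale x p i

  addL-cong : ∀ {p p' q q'} → p ≈L p' → q ≈L q' → addL p q ≈L addL p' q'
  addL-cong {p} {p'} {q} {q'} (mk p≈p') (mk q≈q') = mk λ i →
    trans (coeff-add p q i) (trans (+-cong (p≈p' i) (q≈q' i)) (sym (coeff-add p' q' i)))

  addL-congˡ : ∀ p {q q'} → q ≈L q' → addL p q ≈L addL p q'
  addL-congˡ p = addL-cong (≈L-refl {p})

  addL-congʳ : ∀ {p p'} q → p ≈L p' → addL p q ≈L addL p' q
  addL-congʳ q p≈p' = addL-cong p≈p' (≈L-refl {q})

  negL-cong : ∀ {p q} → p ≈L q → negL p ≈L negL q
  negL-cong {p} {q} (mk p≈q) = mk λ i →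
    trans (coeff-neg p i) (trans (-‿cong (p≈q i)) (sym (coeff-neg q i)))

  +L-isAbelianGroup : IsAbelianGroup _≈L_ addL [] negL
  +L-isAbelianGroup = record
    { isGroup = record
      { isMonoid = record
        { isSemigroup = record
          { isMagma = record
            { isEquivalence = record { refl = ≈L-refl ; sym = ≈L-sym ; trans = ≈L-trans }
            ; ∙-cong = addL-cong }
          ; assoc = λ p q r → mk λ i → begin
              coeff (addL (addL p q) r) i    ≈⟨ trans (coeff-add (addL p q) r i) (+-congʳ (coeff-add p q i)) ⟩
              (coeff p i + coeff q i) + coeff r i  ≈⟨ +-assoc _ _ _ ⟩
              coeff p i + (coeff q i + coeff r i)  ≈⟨ sym (trans (coeff-add p (addL q r) i) (+-congˡ (coeff-add q r i))) ⟩
              coeff (addL p (addL q r)) i    ∎ }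
        ; identity = (λ p → ≈L-refl) , (λ p → mk λ i → trans (coeff-add p [] i) (+-identityʳ _)) }
      ; inverse = (λ p → mk λ i → trans (coeff-add (negL p) p i) (trans (+-congʳ (coeff-neg p i)) (-‿inverseˡ _)))
                , (λ p → mk λ i → trans (coeff-add p (negL p) i) (trans (+-congˡ (coeff-neg p i)) (-‿inverseʳ _)))
      ; ⁻¹-cong = negL-cong }
    ; comm = λ p q → mk λ i → trans (coeff-add p q i) (trans (+-comm _ _) (sym (coeff-add q p i))) }
    where open import Relation.Binary.Reasoning.Setoid setoid

  +L-abelianGroup : AbelianGroup a ℓ
  +L-abelianGroup = record { isAbelianGroup = +L-isAbelianGroup }

  open AbelianGroup +L-abelianGroup public
    using () renaming (identityʳ to addL-identityʳ)
  open import Algebra.Properties.CommutativeSemigroup (AbelianGroup.commutativeSemigroup +L-abelianGroup)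
    using (interchange; x∙yz≈y∙xz)

  scale-cong : ∀ {x y p q} → x ≈ y → p ≈L q → scale x p ≈L scale y q
  scale-cong {x} {y} {p} {q} x≈y (mk p≈q) = mk λ i →
    trans (coeff-scale x p i) (trans (*-cong x≈y (p≈q i)) (sym (coeff-scale y q i)))

  scale-addL : ∀ x p q → scale x (addL p q) ≈L addL (scale x p) (scale x q)
  scale-addL x p q = mk λ i → begin
    coeff (scale x (addL p q)) i          ≈⟨ trans (coeff-scale x (addL p q) i) (*-congˡ (coeff-add p q i)) ⟩
    x * (coeff p i + coeff q i)           ≈⟨ distribˡ x _ _ ⟩
    x * coeff p i + x * coeff q i
      ≈⟨ sym (trans (coeff-add (scale x p) (scale x q) i) (+-cong (coeff-scale x p i) (coeff-scale x q i))) ⟩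
    coeff (addL (scale x p) (scale x q)) i ∎
    where open import Relation.Binary.Reasoning.Setoid setoid

  scale-zero : ∀ {x} p → x ≈ 0# → scale x p ≈L []
  scale-zero {x} p x≈0 = mk λ i → trans (coeff-scale x p i) (trans (*-congʳ x≈0) (zeroˡ _))

  scale-one : ∀ p → scale 1# p ≈L p
  scale-one p = mk λ i → trans (coeff-scale 1# p i) (*-identityˡ _)

  scale-scale : ∀ x y p → scale x (scale y p) ≈L scale (x * y) p
  scale-scale x y p = mk λ i →
    trans (coeff-scale x (scale y p) i) (trans (*-congˡ (coeff-scale y p i))
      (trans (sym (*-assoc x y _)) (sym (coeff-scale (x * y) p i))))

  common-factor : ∀ c ds → (∀ i → ∃ λ f → coeff ds i ≈ c * f) → ∃ λ fs → ds ≈L scale c fs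
  common-factor c []       _         = [] , ≈L-refl
  common-factor c (d ∷ ds) multiples with multiples 0 | common-factor c ds (λ i → multiples (suc i))
  ... | f , d≈cf | fs , ds≈cfs = f ∷ fs , ∷-cong d≈cf ds≈cfs

  mulL-zeroˡ : ∀ p q → p ≈L [] → mulL p q ≈L []
  mulL-zeroˡ []      q _   = ≈L-refl
  mulL-zeroˡ (x ∷ p) q p≈0 = addL-cong (scale-zero q (get p≈0 zero)) (∷-zero refl (mulL-zeroˡ p q (∷-zero-tail p≈0)))

  mulL-zeroʳ : ∀ p → mulL p [] ≈L []
  mulL-zeroʳ []      = ≈L-refl
  mulL-zeroʳ (x ∷ p) = ∷-zero refl (mulL-zeroʳ p)

  mulL-congʳ : ∀ p {q q'} → q ≈L q' → mulL p q ≈L mulL p q'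
  mulL-congʳ []      q≈q' = ≈L-refl
  mulL-congʳ (x ∷ p) q≈q' = addL-cong (scale-cong refl q≈q') (∷-cong refl (mulL-congʳ p q≈q'))

  mulL-congˡ : ∀ {p p'} q → p ≈L p' → mulL p q ≈L mulL p' q
  mulL-congˡ {[]}    {[]}     q _     = ≈L-refl
  mulL-congˡ {[]}    {y ∷ p'} q p≈p' = ≈L-sym (mulL-zeroˡ (y ∷ p') q (≈L-sym p≈p'))
  mulL-congˡ {x ∷ p} {[]}     q p≈p' = mulL-zeroˡ (x ∷ p) q p≈p'
  mulL-congˡ {x ∷ p} {y ∷ p'} q p≈p' =
    addL-cong (scale-cong (get p≈p' zero) ≈L-refl) (∷-cong refl (mulL-congˡ q (∷-tail p≈p')))

  mulL-cong : ∀ {p p' q q'} → p ≈L p' → q ≈L q' → mulL p q ≈L mulL p' q'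
  mulL-cong {p' = p'} {q = q} p≈p' q≈q' = ≈L-trans (mulL-congˡ q p≈p') (mulL-congʳ p' q≈q')

  mulL-shiftˡ : ∀ p q → mulL (0# ∷ p) q ≈L (0# ∷ mulL p q)
  mulL-shiftˡ p q = addL-cong (scale-zero q refl) ≈L-refl

  mulL-∷ʳ : ∀ p y q → mulL p (y ∷ q) ≈L addL (scale y p) (0# ∷ mulL p q)
  mulL-∷ʳ []      y q = ≈L-sym (∷-zero refl ≈L-refl)
  mulL-∷ʳ (x ∷ p) y q = ∷-cong (+-congʳ (*-comm x y)) (begin
    addL (scale x q) (mulL p (y ∷ q))                        ≈⟨ addL-cong ≈L-refl (mulL-∷ʳ p y q) ⟩
    addL (scale x q) (addL (scale y p) (0# ∷ mulL p q))      ≈⟨ x∙yz≈y∙xz (scale x q) (scale y p) _ ⟩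
    addL (scale y p) (addL (scale x q) (0# ∷ mulL p q))      ∎)
    where open ≈L-Reasoning

  mulL-comm : ∀ p q → mulL p q ≈L mulL q p
  mulL-comm []      q = ≈L-sym (mulL-zeroʳ q)
  mulL-comm (x ∷ p) q =
    ≈L-trans (addL-cong ≈L-refl (∷-cong refl (mulL-comm p q))) (≈L-sym (mulL-∷ʳ q x p))

  mulL-distribˡ : ∀ p q r → mulL p (addL q r) ≈L addL (mulL p q) (mulL p r)
  mulL-distribˡ []      q r = ≈L-refl
  mulL-distribˡ (x ∷ p) q r = begin
    addL (scale x (addL q r)) (0# ∷ mulL p (addL q r))
      ≈⟨ addL-cong (scale-addL x q r) (∷-cong (sym (+-identityˡ 0#)) (mulL-distribˡ p q r)) ⟩
    addL (addL (scale x q) (scale x r)) (addL (0# ∷ mulL p q) (0# ∷ mulL p r))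
      ≈⟨ interchange (scale x q) (scale x r) _ _ ⟩
    addL (addL (scale x q) (0# ∷ mulL p q)) (addL (scale x r) (0# ∷ mulL p r)) ∎
    where open ≈L-Reasoning

  mulL-distribʳ : ∀ p q r → mulL (addL q r) p ≈L addL (mulL q p) (mulL r p)
  mulL-distribʳ p q r = begin
    mulL (addL q r) p            ≈⟨ mulL-comm (addL q r) p ⟩
    mulL p (addL q r)            ≈⟨ mulL-distribˡ p q r ⟩
    addL (mulL p q) (mulL p r)   ≈⟨ addL-cong (mulL-comm p q) (mulL-comm p r) ⟩
    addL (mulL q p) (mulL r p)   ∎
    where open ≈L-Reasoning

  mulL-scaleˡ : ∀ x p q → mulL (scale x p) q ≈L scale x (mulL p q)
  mulL-scaleˡ x []      q = ≈L-refl
  mulL-scaleˡ x (y ∷ p) q = begin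
    addL (scale (x * y) q) (0# ∷ mulL (scale x p) q)
      ≈⟨ addL-cong (≈L-sym (scale-scale x y q)) (∷-cong (sym (zeroʳ x)) (mulL-scaleˡ x p q)) ⟩
    addL (scale x (scale y q)) (scale x (0# ∷ mulL p q)) ≈⟨ ≈L-sym (scale-addL x (scale y q) _) ⟩
    scale x (mulL (y ∷ p) q)                           ∎
    where open ≈L-Reasoning

  mulL-assoc : ∀ p q r → mulL (mulL p q) r ≈L mulL p (mulL q r)
  mulL-assoc []      q r = ≈L-refl
  mulL-assoc (x ∷ p) q r = begin
    mulL (addL (scale x q) (0# ∷ mulL p q)) r                 ≈⟨ mulL-distribʳ r (scale x q) _ ⟩
    addL (mulL (scale x q) r) (mulL (0# ∷ mulL p q) r)        ≈⟨ addL-cong (mulL-scaleˡ x q r) (mulL-shiftˡ (mulL p q) r) ⟩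
    addL (scale x (mulL q r)) (0# ∷ mulL (mulL p q) r)        ≈⟨ addL-cong ≈L-refl (∷-cong refl (mulL-assoc p q r)) ⟩
    addL (scale x (mulL q r)) (0# ∷ mulL p (mulL q r))        ∎
    where open ≈L-Reasoning

  mulL-identityˡ : ∀ q → mulL (1# ∷ []) q ≈L q
  mulL-identityˡ q = ≈L-trans (addL-cong (scale-one q) (∷-zero refl ≈L-refl)) (addL-identityʳ q)

  R[x]-isCommutativeRing : IsCommutativeRing _≈L_ addL mulL negL [] (1# ∷ [])
  R[x]-isCommutativeRing = record
    { isRing = record
      { +-isAbelianGroup = +L-isAbelianGroup
      ; *-cong = mulL-cong
      ; *-assoc = mulL-assoc
      ; *-identity = mulL-identityˡ , λ q → ≈L-trans (mulL-comm q (1# ∷ [])) (mulL-identityˡ q)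
      ; distrib = mulL-distribˡ , mulL-distribʳ }
    ; *-comm = mulL-comm }

  R[x] : CommutativeRing a ℓ
  R[x] = record { isCommutativeRing = R[x]-isCommutativeRing }

  eval₁ : List A → A
  eval₁ []      = 0#
  eval₁ (x ∷ p) = x + eval₁ p

  eval₁-zero : ∀ {p} → p ≈L [] → eval₁ p ≈ 0#
  eval₁-zero {[]}    _   = refl
  eval₁-zero {x ∷ p} p≈0 = trans (+-cong (get p≈0 zero) (eval₁-zero (∷-zero-tail p≈0))) (+-identityˡ 0#)

  eval₁-cong : ∀ {p q} → p ≈L q → eval₁ p ≈ eval₁ q
  eval₁-cong {[]}    {[]}    _   = refl
  eval₁-cong {[]}    {y ∷ q} p≈q = sym (eval₁-zero (≈L-sym p≈q))
  eval₁-cong {x ∷ p} {[]}    p≈q = eval₁-zero p≈q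
  eval₁-cong {x ∷ p} {y ∷ q} p≈q = +-cong (get p≈q zero) (eval₁-cong (∷-tail p≈q))

  eval₁-addL : ∀ p q → eval₁ (addL p q) ≈ eval₁ p + eval₁ q
  eval₁-addL []      q       = sym (+-identityˡ _)
  eval₁-addL (x ∷ p) []      = sym (+-identityʳ _)
  eval₁-addL (x ∷ p) (y ∷ q) = trans (+-congˡ (eval₁-addL p q)) (+-interchange x y (eval₁ p) (eval₁ q))
    where open import Algebra.Properties.CommutativeSemigroup +-commutativeSemigroup
            using () renaming (interchange to +-interchange)

  eval₁-negL : ∀ p → eval₁ (negL p) ≈ - eval₁ p
  eval₁-negL []      = sym -0#≈0#
  eval₁-negL (x ∷ p) = trans (+-congˡ (eval₁-negL p)) (-‿+-comm x (eval₁ p))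

  eval₁-scale : ∀ x p → eval₁ (scale x p) ≈ x * eval₁ p
  eval₁-scale x []      = sym (zeroʳ x)
  eval₁-scale x (y ∷ p) = trans (+-congˡ (eval₁-scale x p)) (sym (distribˡ x y (eval₁ p)))

  eval₁-mulL : ∀ p q → eval₁ (mulL p q) ≈ eval₁ p * eval₁ q
  eval₁-mulL []      q = sym (zeroˡ _)
  eval₁-mulL (x ∷ p) q = begin
    eval₁ (addL (scale x q) (0# ∷ mulL p q))       ≈⟨ eval₁-addL (scale x q) (0# ∷ mulL p q) ⟩
    eval₁ (scale x q) + (0# + eval₁ (mulL p q))    ≈⟨ +-cong (eval₁-scale x q) (trans (+-identityˡ _) (eval₁-mulL p q)) ⟩
    x * eval₁ q + eval₁ p * eval₁ q                ≈⟨ sym (distribʳ (eval₁ q) x (eval₁ p)) ⟩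
    (x + eval₁ p) * eval₁ q                        ∎
    where open import Relation.Binary.Reasoning.Setoid setoid

  eval₁-isRingHomomorphism : IsRingHomomorphism (CommutativeRing.rawRing R[x]) rawRing eval₁
  eval₁-isRingHomomorphism = ring-homomorphism eval₁-cong eval₁-addL eval₁-mulL eval₁-negL refl (+-identityʳ 1#)

  x-1 : List A
  x-1 = addL (0# ∷ 1# ∷ []) (negL (1# ∷ []))

  -- Quotient of p by x - 1 (synthetic division: the k-th coefficient is the sum of the
  -- coefficients of p of degree > k).
  quot₁ : List A → List A
  quot₁ []      = []
  quot₁ (x ∷ p) = eval₁ p ∷ quot₁ p

  division-by-x-1 : ∀ p → p ≈L addL (mulL x-1 (quot₁ p)) (eval₁ p ∷ [])
  division-by-x-1 []      = ≈L-sym (≈L-trans (addL-congʳ (0# ∷ []) (mulL-zeroʳ x-1)) (∷-zero refl ≈L-refl))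
  division-by-x-1 (x ∷ p) = begin
    x ∷ p                                                       ≈⟨ ∷-as-sum x p ⟩
    addL [ x ] (mulL X p)                                       ≈⟨ addL-congˡ [ x ] (mulL-cong X≈x-1+1 (division-by-x-1 p)) ⟩
    addL [ x ] (mulL (addL x-1 [ 1# ]) (addL (mulL x-1 (quot₁ p)) [ eval₁ p ]))
      ≈⟨ expand [ x ] x-1 [ 1# ] (quot₁ p) [ eval₁ p ] ⟩
    addL (mulL x-1 (addL [ eval₁ p ] (mulL (addL x-1 [ 1# ]) (quot₁ p)))) (addL [ x ] (mulL [ 1# ] [ eval₁ p ]))
      ≈⟨ addL-cong (mulL-congʳ x-1 (≈L-trans (addL-congˡ [ eval₁ p ] (mulL-congˡ (quot₁ p) (≈L-sym X≈x-1+1)))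
                                             (≈L-sym (∷-as-sum (eval₁ p) (quot₁ p)))))
                   (addL-congˡ [ x ] (mulL-identityˡ [ eval₁ p ])) ⟩
    addL (mulL x-1 (eval₁ p ∷ quot₁ p)) (addL [ x ] [ eval₁ p ])  ∎
    where
      open ≈L-Reasoning
      [_] : A → List A
      [ y ] = y ∷ []
      X : List A
      X = 0# ∷ 1# ∷ []
      ∷-as-sum : ∀ y q → (y ∷ q) ≈L addL [ y ] (mulL X q)
      ∷-as-sum y q = ≈L-sym (≈L-trans (addL-congˡ [ y ] (≈L-trans (mulL-shiftˡ (1# ∷ []) q) (∷-cong refl (mulL-identityˡ q))))
                                      (∷-cong (+-identityʳ y) ≈L-refl))
      X≈x-1+1 : X ≈L addL x-1 [ 1# ]
      X≈x-1+1 = ∷-cong (sym (trans (+-congʳ (+-identityˡ (- 1#))) (-‿inverseˡ 1#))) ≈L-refl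
      module S = SemiringSolver (CommutativeRing.commutativeSemiring R[x])
      expand : ∀ a t o d b → addL a (mulL (addL t o) (addL (mulL t d) b))
                           ≈L addL (mulL t (addL b (mulL (addL t o) d))) (addL a (mulL o b))
      expand = S.solve 5 (λ a t o d b → a S.:+ (t S.:+ o) S.:* (t S.:* d S.:+ b)
                                        S.:= t S.:* (b S.:+ (t S.:+ o) S.:* d) S.:+ (a S.:+ o S.:* b)) ≈L-refl

  module IntegralDomain (≈0? : ∀ x → Dec (x ≈ 0#))
                        (no-zero-divisors : ∀ x y → x * y ≈ 0# → x ≈ 0# ⊎ y ≈ 0#) where

    ≈L0? : ∀ p → Dec (p ≈L [])
    ≈L0? []      = yes ≈L-refl
    ≈L0? (x ∷ p) with ≈0? x | ≈L0? p
    ... | yes x≈0 | yes p≈0 = yes (∷-zero x≈0 p≈0)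
    ... | no x≉0  | _       = no λ xp≈0 → x≉0 (get xp≈0 zero)
    ... | yes _   | no p≉0  = no λ xp≈0 → p≉0 (∷-zero-tail xp≈0)

    -- A product whose left factor has a nonzero constant term x vanishes only if the right
    -- factor does: induction on the right factor, whose constant term y satisfies x y = 0.
    nonzero-constant-cancels : ∀ x p → ¬ (x ≈ 0#) → ∀ q → mulL (x ∷ p) q ≈L [] → q ≈L []
    nonzero-constant-cancels x p x≉0 []      _     = ≈L-refl
    nonzero-constant-cancels x p x≉0 (y ∷ q) xpyq≈0 with no-zero-divisors x y (trans (sym (+-identityʳ (x * y))) (get xpyq≈0 zero))
    ... | inj₁ x≈0 = contradiction x≈0 x≉0
    ... | inj₂ y≈0 = ∷-zero y≈0 (nonzero-constant-cancels x p x≉0 q (∷-zero-tail (begin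
        0# ∷ mulL (x ∷ p) q
          ≈⟨ ≈L-sym (addL-congʳ (0# ∷ mulL (x ∷ p) q) (scale-zero (x ∷ p) y≈0)) ⟩
        addL (scale y (x ∷ p)) (0# ∷ mulL (x ∷ p) q)         ≈⟨ ≈L-sym (mulL-∷ʳ (x ∷ p) y q) ⟩
        mulL (x ∷ p) (y ∷ q)                                 ≈⟨ xpyq≈0 ⟩
        []                                                   ∎)))
      where open ≈L-Reasoning

    mulL-no-zero-divisors : ∀ p q → mulL p q ≈L [] → p ≈L [] ⊎ q ≈L []
    mulL-no-zero-divisors []      q _ = inj₁ ≈L-refl
    mulL-no-zero-divisors (x ∷ p) q xpq≈0 with ≈0? x
    ... | no x≉0  = inj₂ (nonzero-constant-cancels x p x≉0 q xpq≈0)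
    ... | yes x≈0 with mulL-no-zero-divisors p q
                         (∷-zero-tail (≈L-trans (≈L-sym (addL-congʳ (0# ∷ mulL p q) (scale-zero q x≈0))) xpq≈0))
    ...   | inj₁ p≈0 = inj₁ (∷-zero x≈0 p≈0)
    ...   | inj₂ q≈0 = inj₂ q≈0


module CoefficientMap {a b ℓ₁ ℓ₂} {R : CommutativeRing a ℓ₁} {S : CommutativeRing b ℓ₂}
                      {f : CommutativeRing.Carrier R → CommutativeRing.Carrier S}
                      (f-hom : IsRingHomomorphism (CommutativeRing.rawRing R) (CommutativeRing.rawRing S) f) where
  private
    module R = CommutativeRing R
    module R[x] = Univariate R
    module S[x] = Univariate S
  open CommutativeRing S
  open IsRingHomomorphism f-hom
  open S[x] using (_≈L_; mk)

  coeff-map : ∀ p i → S[x].coeff (map f p) i ≈ f (R[x].coeff p i)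
  coeff-map []      i       = sym 0#-homo
  coeff-map (x ∷ p) zero    = refl
  coeff-map (x ∷ p) (suc i) = coeff-map p i

  map-cong : ∀ {p q} → p R[x].≈L q → map f p ≈L map f q
  map-cong {p} {q} p≈q = mk λ i → trans (coeff-map p i) (trans (⟦⟧-cong (R[x].get p≈q i)) (sym (coeff-map q i)))

  map-addL : ∀ p q → map f (R[x].addL p q) ≈L S[x].addL (map f p) (map f q)
  map-addL p q = mk λ i → trans (coeff-map (R[x].addL p q) i) (trans (⟦⟧-cong (R[x].coeff-add p q i))
    (trans (+-homo _ _) (sym (trans (S[x].coeff-add (map f p) (map f q) i) (+-cong (coeff-map p i) (coeff-map q i))))))

  map-negL : ∀ p → map f (R[x].negL p) ≈L S[x].negL (map f p)
  map-negL p = mk λ i → trans (coeff-map (R[x].negL p) i) (trans (⟦⟧-cong (R[x].coeff-neg p i))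
    (trans (-‿homo _) (sym (trans (S[x].coeff-neg (map f p) i) (-‿cong (coeff-map p i))))))

  map-scale : ∀ x p → map f (R[x].scale x p) ≈L S[x].scale (f x) (map f p)
  map-scale x p = mk λ i → trans (coeff-map (R[x].scale x p) i) (trans (⟦⟧-cong (R[x].coeff-scale x p i))
    (trans (*-homo _ _) (sym (trans (S[x].coeff-scale (f x) (map f p) i) (*-congˡ (coeff-map p i))))))

  map-mulL : ∀ p q → map f (R[x].mulL p q) ≈L S[x].mulL (map f p) (map f q)
  map-mulL []      q = S[x].≈L-refl
  map-mulL (x ∷ p) q = S[x].≈L-trans (map-addL (R[x].scale x q) (R.0# ∷ R[x].mulL p q))
                                     (S[x].addL-cong (map-scale x q) (S[x].∷-cong 0#-homo (map-mulL p q)))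

  map-eval₁ : ∀ p → f (R[x].eval₁ p) ≈ S[x].eval₁ (map f p)
  map-eval₁ []      = 0#-homo
  map-eval₁ (x ∷ p) = trans (+-homo _ _) (+-congˡ (map-eval₁ p))

  map-isRingHomomorphism : IsRingHomomorphism (CommutativeRing.rawRing R[x].R[x]) (CommutativeRing.rawRing S[x].R[x]) (map f)
  map-isRingHomomorphism =
    ring-homomorphism map-cong map-addL map-mulL map-negL S[x].≈L-refl (S[x].∷-cong 1#-homo S[x].≈L-refl)

-- The polynomials Poly m of Defs form a commutative ring, and Poly (suc m) is (Poly m)[x]:
-- the coefficient-list operations of Defs agree with those of `Univariate`.
module PolynomialRing {c ℓ} (F : Field c ℓ) where
  open Polynomials F
  private module F = Field F

  -- Coefficientwise equality, wrapped in a record so that both sides can be inferred.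
  infix 4 _≋_
  record _≋_ {m} (a b : Poly m) : Set ℓ where
    constructor mk≋
    field get≋ : a ≈P b
  open _≋_ public

  rawPoly : ℕ → RawRing c ℓ
  rawPoly m = record { Carrier = Poly m ; _≈_ = _≋_ ; _+_ = addP ; _*_ = mulP ; -_ = negP ; 0# = zeroP ; 1# = oneP }

  unconst : Poly zero → F.Carrier
  unconst (const x) = x

  unconst-isRingMonomorphism : IsRingMonomorphism (rawPoly zero) F.rawRing unconst
  unconst-isRingMonomorphism = record
    { isRingHomomorphism = ring-homomorphism (λ { {const x} {const y} (mk≋ x≈y) → x≈y λ () })
        (λ { (const x) (const y) → F.refl }) (λ { (const x) (const y) → F.refl }) (λ { (const x) → F.refl }) F.refl F.refl
    ; injective = λ { {const x} {const y} x≈y → mk≋ λ _ → x≈y } }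

  PolyRing : ℕ → CommutativeRing c ℓ
  PolyRing-isCommutativeRing : ∀ m → IsCommutativeRing (_≋_ {m}) addP mulP negP zeroP oneP

  PolyRing m = record { isCommutativeRing = PolyRing-isCommutativeRing m }

  module AsUnivariate (m : ℕ) where
    module U = Univariate (PolyRing m)

    lookupD≡coeff : ∀ p i → lookupD p i ≡ U.coeff p i
    lookupD≡coeff []      i       = ≡.refl
    lookupD≡coeff (x ∷ p) zero    = ≡.refl
    lookupD≡coeff (x ∷ p) (suc i) = lookupD≡coeff p i

    addL≡ : ∀ p q → addL p q ≡ U.addL p q
    addL≡ []      q       = ≡.refl
    addL≡ (x ∷ p) []      = ≡.refl
    addL≡ (x ∷ p) (y ∷ q) = ≡.cong (addP x y ∷_) (addL≡ p q)

    negL≡ : ∀ p → negL p ≡ U.negL p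
    negL≡ []      = ≡.refl
    negL≡ (x ∷ p) = ≡.cong (negP x ∷_) (negL≡ p)

    mulL≡ : ∀ p q → mulL p q ≡ U.mulL p q
    mulL≡ []      q = ≡.refl
    mulL≡ (x ∷ p) q = ≡.trans (addL≡ (map (mulP x) q) (zeroP ∷ mulL p q))
                              (≡.cong (λ r → U.addL (map (mulP x) q) (zeroP ∷ r)) (mulL≡ p q))

    toList : Poly (suc m) → List (Poly m)
    toList (poly p) = p

    extend : ℕ → (Fin m → ℕ) → Fin (suc m) → ℕ
    extend i e zero    = i
    extend i e (suc j) = e j

    toList-cong : ∀ {a b} → a ≋ b → toList a U.≈L toList b
    toList-cong {poly p} {poly q} (mk≋ p≈q) = U.mk λ i →
      ≡.subst₂ _≋_ (lookupD≡coeff p i) (lookupD≡coeff q i) (mk≋ λ e → p≈q (extend i e))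

    toList-injective : ∀ {a b} → toList a U.≈L toList b → a ≋ b
    toList-injective {poly p} {poly q} (U.mk p≈q) = mk≋ λ e →
      get≋ (≡.subst₂ _≋_ (≡.sym (lookupD≡coeff p (e zero))) (≡.sym (lookupD≡coeff q (e zero))) (p≈q (e zero)))
           (λ j → e (suc j))

    toList-injective≡ : ∀ {p q p' q'} → p ≡ p' → q ≡ q' → p' U.≈L q' → poly p ≋ poly q
    toList-injective≡ ≡.refl ≡.refl = toList-injective

    toList-isRingMonomorphism : IsRingMonomorphism (rawPoly (suc m)) (CommutativeRing.rawRing U.R[x]) toList
    toList-isRingMonomorphism = record
      { isRingHomomorphism = ring-homomorphism toList-cong
          (λ { (poly p) (poly q) → ≡⇒≈L (addL≡ p q) }) (λ { (poly p) (poly q) → ≡⇒≈L (mulL≡ p q) })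
          (λ { (poly p) → ≡⇒≈L (negL≡ p) }) U.≈L-refl U.≈L-refl
      ; injective = toList-injective }
      where
        ≡⇒≈L : ∀ {p q} → p ≡ q → p U.≈L q
        ≡⇒≈L ≡.refl = U.≈L-refl

    toList-isRingHomomorphism : IsRingHomomorphism (rawPoly (suc m)) (CommutativeRing.rawRing U.R[x]) toList
    toList-isRingHomomorphism = IsRingMonomorphism.isRingHomomorphism toList-isRingMonomorphism

  PolyRing-isCommutativeRing zero    = RingMonomorphism.isCommutativeRing unconst-isRingMonomorphism F.isCommutativeRing
  PolyRing-isCommutativeRing (suc m) = RingMonomorphism.isCommutativeRing (AsUnivariate.toList-isRingMonomorphism m)
                                         (Univariate.R[x]-isCommutativeRing (PolyRing m))

  private
    module P (m : ℕ) = CommutativeRing (PolyRing m)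
    module A (m : ℕ) = AsUnivariate m

  module IntegralDomain (≈0? : ∀ x → Dec (x F.≈ F.0#)) where
    ≋0? : ∀ {m} (a : Poly m) → Dec (a ≋ zeroP)
    no-zero-divisors : ∀ {m} (a b : Poly m) → mulP a b ≋ zeroP → a ≋ zeroP ⊎ b ≋ zeroP

    ≋0? (const x) with ≈0? x
    ... | yes x≈0 = yes (mk≋ λ _ → x≈0)
    ... | no x≉0  = no λ x≋0 → x≉0 (get≋ x≋0 λ ())
    ≋0? {suc m} (poly p) with A.U.IntegralDomain.≈L0? m ≋0? no-zero-divisors p
    ... | yes p≈0 = yes (A.toList-injective m p≈0)
    ... | no p≉0  = no λ p≋0 → p≉0 (A.toList-cong m p≋0)

    no-zero-divisors (const x) (const y) xy≋0 with FieldProperties.no-zero-divisors F ≈0? x y (get≋ xy≋0 λ ())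
    ... | inj₁ x≈0 = inj₁ (mk≋ λ _ → x≈0)
    ... | inj₂ y≈0 = inj₂ (mk≋ λ _ → y≈0)
    no-zero-divisors {suc m} (poly p) (poly q) pq≋0
      with A.U.IntegralDomain.mulL-no-zero-divisors m ≋0? no-zero-divisors p q
             (≡.subst (λ r → A.U._≈L_ m r []) (A.mulL≡ m p q) (A.toList-cong m pq≋0))
    ... | inj₁ p≈0 = inj₁ (A.toList-injective m p≈0)
    ... | inj₂ q≈0 = inj₂ (A.toList-injective m q≈0)

  ≡⇒≋ : ∀ {m} {a b : Poly m} → a ≡ b → a ≋ b
  ≡⇒≋ {m} ≡.refl = P.refl m

  poly-isRingHomomorphism : ∀ m → IsRingHomomorphism (CommutativeRing.rawRing (A.U.R[x] m)) (rawPoly (suc m)) poly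
  poly-isRingHomomorphism m = ring-homomorphism (A.toList-injective m)
    (λ p q → ≡⇒≋ (≡.cong poly (≡.sym (A.addL≡ m p q)))) (λ p q → ≡⇒≋ (≡.cong poly (≡.sym (A.mulL≡ m p q))))
    (λ p → ≡⇒≋ (≡.cong poly (≡.sym (A.negL≡ m p)))) (P.refl (suc m)) (P.refl (suc m))

  const₀ : ∀ {m} → Poly m → Poly (suc m)
  const₀ a = poly (a ∷ [])

  const₀-isRingHomomorphism : ∀ m → IsRingHomomorphism (rawPoly m) (rawPoly (suc m)) const₀
  const₀-isRingHomomorphism m = ring-homomorphism
    (λ a≋b → A.toList-injective m (A.U.∷-cong m a≋b (A.U.≈L-refl m)))
    (λ a b → P.refl (suc m))
    (λ a b → A.toList-injective m (A.U.∷-cong m (P.sym m (P.+-identityʳ m (mulP a b))) (A.U.≈L-refl m)))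
    (λ a → P.refl (suc m))
    (A.toList-injective m (A.U.∷-zero m (P.refl m) (A.U.≈L-refl m)))
    (P.refl (suc m))

  set1 : ∀ {m} → Fin m → Poly m → Poly m
  set1 {suc m} zero    a = const₀ (A.U.eval₁ m (A.toList m a))
  set1 {suc m} (suc j) a = poly (map (set1 j) (A.toList m a))

  set1-isRingHomomorphism : ∀ {m} (j : Fin m) → IsRingHomomorphism (rawPoly m) (rawPoly m) (set1 j)
  set1-isRingHomomorphism {suc m} zero =
    Compose.isRingHomomorphism (P.trans (suc m))
      (Compose.isRingHomomorphism (P.trans m) (A.toList-isRingHomomorphism m) (A.U.eval₁-isRingHomomorphism m))
      (const₀-isRingHomomorphism m)
  set1-isRingHomomorphism {suc m} (suc j) =
    Compose.isRingHomomorphism (P.trans (suc m))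
      (Compose.isRingHomomorphism (A.U.≈L-trans m) (A.toList-isRingHomomorphism m)
        (CoefficientMap.map-isRingHomomorphism (set1-isRingHomomorphism j)))
      (poly-isRingHomomorphism m)

  ε : ∀ {m} → Poly m → F.Carrier
  ε {zero}  a = unconst a
  ε {suc m} a = ε (A.U.eval₁ m (A.toList m a))

  ε-isRingHomomorphism : ∀ m → IsRingHomomorphism (rawPoly m) F.rawRing ε
  ε-isRingHomomorphism zero    = IsRingMonomorphism.isRingHomomorphism unconst-isRingMonomorphism
  ε-isRingHomomorphism (suc m) =
    Compose.isRingHomomorphism F.trans
      (Compose.isRingHomomorphism (P.trans m) (A.toList-isRingHomomorphism m) (A.U.eval₁-isRingHomomorphism m))
      (ε-isRingHomomorphism m)

  ε-set1 : ∀ {m} (j : Fin m) a → ε (set1 j a) F.≈ ε a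
  ε-set1 {suc m} zero    a = ⟦⟧-cong (P.+-identityʳ m (A.U.eval₁ m (A.toList m a)))
    where open IsRingHomomorphism (ε-isRingHomomorphism m)
  ε-set1 {suc m} (suc j) a = F.trans (⟦⟧-cong (P.sym m (map-eval₁ (A.toList m a)))) (ε-set1 j (A.U.eval₁ m (A.toList m a)))
    where open IsRingHomomorphism (ε-isRingHomomorphism m)
          open CoefficientMap (set1-isRingHomomorphism j)

  oneP≉zeroP : ∀ {m} → ¬ (oneP {m} ≋ zeroP)
  oneP≉zeroP {m} 1≋0 = F.1≉0 (F.trans (F.sym 1#-homo) (F.trans (⟦⟧-cong 1≋0) 0#-homo))
    where open IsRingHomomorphism (ε-isRingHomomorphism m)

  X : ∀ {m} → Fin m → Poly m
  X j = subP (var j) oneP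

  X₀≉0 : ∀ {m} → ¬ (X {suc m} zero ≋ zeroP)
  X₀≉0 {m} X₀≋0 = oneP≉zeroP (A.U.get (A.toList-cong m X₀≋0) 1)

  set1-X : ∀ {m} (j : Fin m) → set1 j (X j) ≋ zeroP
  set1-X {suc m} zero = A.toList-injective m (A.U.∷-zero m
    (P.trans m (P.+-cong m (P.+-identityˡ m (negP oneP)) (P.+-identityʳ m oneP)) (P.-‿inverseˡ m oneP)) (A.U.≈L-refl m))
  set1-X {suc m} (suc j) = A.toList-injective m (A.U.∷-zero m (set1-X j) (A.U.≈L-refl m))

  set1-X₀ : ∀ {m} (j : Fin m) → set1 (suc j) (X zero) ≋ X zero
  set1-X₀ {m} j = A.toList-injective m
    (A.U.∷-cong m (P.trans m (+-homo zeroP (negP oneP)) (P.+-cong m 0#-homo (P.trans m (-‿homo oneP) (P.-‿cong m 1#-homo))))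
                  (A.U.∷-cong m 1#-homo (A.U.≈L-refl m)))
    where open IsRingHomomorphism (set1-isRingHomomorphism j)

  division-by-X₀ : ∀ {m} (a : Poly (suc m)) → ∃ λ q → a ≋ addP (mulP (X zero) q) (set1 zero a)
  division-by-X₀ {m} (poly p) = poly (A.U.quot₁ m p) ,
    A.toList-injective≡ m ≡.refl
      (≡.trans (A.addL≡ m (mulL (A.toList m (X zero)) (A.U.quot₁ m p)) (A.U.eval₁ m p ∷ []))
               (≡.cong (λ r → A.U.addL m r (A.U.eval₁ m p ∷ [])) (A.mulL≡ m (A.toList m (X zero)) (A.U.quot₁ m p))))
      (A.U.division-by-x-1 m p)

  module PowersAndProducts (m : ℕ) where
    open CommutativeRing (PolyRing m) hiding (zero)
    open SemiringSolver commutativeSemiring using (solve; _:*_; _:=_)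

    powP-cong : ∀ {a b} k → a ≋ b → powP a k ≋ powP b k
    powP-cong zero    a≋b = refl
    powP-cong (suc k) a≋b = *-cong a≋b (powP-cong k a≋b)

    powP-mulP : ∀ a b k → powP (mulP a b) k ≋ mulP (powP a k) (powP b k)
    powP-mulP a b zero    = sym (*-identityˡ oneP)
    powP-mulP a b (suc k) = trans (*-congˡ (powP-mulP a b k))
      (solve 4 (λ a b a^k b^k → (a :* b) :* (a^k :* b^k) := (a :* a^k) :* (b :* b^k)) refl a b (powP a k) (powP b k))

    prodFin-powP : ∀ {n} (g : Fin n → Poly m) k → powP (prodFin g) k ≋ prodFin (λ j → powP (g j) k)
    prodFin-powP {zero}  g zero    = refl
    prodFin-powP {zero}  g (suc k) = trans (*-congˡ (prodFin-powP {zero} g k)) (*-identityˡ oneP)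
    prodFin-powP {suc n} g k       = trans (powP-mulP (g zero) (prodFin (λ j → g (suc j))) k)
                                           (*-congˡ (prodFin-powP (λ j → g (suc j)) k))

    prodFin-zero : ∀ {n} (g : Fin n → Poly m) j → g j ≋ zeroP → prodFin g ≋ zeroP
    prodFin-zero g zero    g₀≋0 = trans (*-congʳ g₀≋0) (zeroˡ _)
    prodFin-zero g (suc j) gj≋0 = trans (*-congˡ (prodFin-zero (λ i → g (suc i)) j gj≋0)) (zeroʳ _)

    powP-zero : ∀ {a} k → a ≋ zeroP → powP a (suc k) ≋ zeroP
    powP-zero k a≋0 = trans (*-congʳ a≋0) (zeroˡ _)

  module PreservesProducts {m n} {f : Poly m → Poly n} (f-hom : IsRingHomomorphism (rawPoly m) (rawPoly n) f) where
    open CommutativeRing (PolyRing n) using (trans; *-congˡ)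
    open IsRingHomomorphism f-hom

    powP-homo : ∀ a k → f (powP a k) ≋ powP (f a) k
    powP-homo a zero    = 1#-homo
    powP-homo a (suc k) = trans (*-homo a (powP a k)) (*-congˡ (powP-homo a k))

    prodFin-homo : ∀ {k} (g : Fin k → Poly m) → f (prodFin g) ≋ prodFin (λ j → f (g j))
    prodFin-homo {zero}  g = 1#-homo
    prodFin-homo {suc k} g = trans (*-homo _ _) (*-congˡ (prodFin-homo (λ j → g (suc j))))

  const₀-mulP : ∀ {m} c fs → mulP (const₀ c) (poly fs) ≋ poly (A.U.scale m c fs)
  const₀-mulP {m} c fs = A.toList-injective≡ m (A.addL≡ m (map (mulP c) fs) (zeroP ∷ [])) ≡.refl
    (A.U.≈L-trans m (A.U.addL-congˡ m (A.U.scale m c fs) (A.U.∷-zero m (P.refl m) (A.U.≈L-refl m)))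
                    (A.U.addL-identityʳ m (A.U.scale m c fs)))

  Π : ∀ m → Poly m
  Π m = prodFin (X {m})

  Π-suc : ∀ m → Π (suc m) ≋ mulP (X zero) (const₀ (Π m))
  Π-suc m = P.*-congˡ (suc m) (P.sym (suc m) (PreservesProducts.prodFin-homo (const₀-isRingHomomorphism m) X))

  -- The factor theorem for the hyperplanes x_j = 1 (needs an integral domain, hence
  -- decidable zero-testing in F).
  module FactorTheorem (≈0? : ∀ x → Dec (x F.≈ F.0#)) where
    open IntegralDomain ≈0?

    -- If a = (x₀ - 1) q vanishes on x_{j+1} = 1, so does q, as x₀ - 1 is a nonzero fixed point.
    quotient-vanishes : ∀ {m} (a q : Poly (suc m)) → a ≋ mulP (X zero) q →
                        ∀ j → set1 (suc j) a ≋ zeroP → set1 (suc j) q ≋ zeroP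
    quotient-vanishes {m} a q a≋X₀q j a-vanishes with no-zero-divisors (X zero) (set1 (suc j) q) (begin
        mulP (X zero) (set1 (suc j) q)                   ≈⟨ *-congʳ (sym (set1-X₀ j)) ⟩
        mulP (set1 (suc j) (X zero)) (set1 (suc j) q)    ≈⟨ sym (*-homo (X zero) q) ⟩
        set1 (suc j) (mulP (X zero) q)                   ≈⟨ ⟦⟧-cong (sym a≋X₀q) ⟩
        set1 (suc j) a                                   ≈⟨ a-vanishes ⟩
        zeroP                                            ∎)
      where open CommutativeRing (PolyRing (suc m)) using (sym; *-congʳ; setoid)
            open IsRingHomomorphism (set1-isRingHomomorphism (suc j))
            open import Relation.Binary.Reasoning.Setoid setoid
    ... | inj₁ X₀≋0 = contradiction X₀≋0 X₀≉0
    ... | inj₂ q-vanishes = q-vanishes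

    factor-theorem : ∀ m (a : Poly m) → (∀ j → set1 j a ≋ zeroP) → ∃ λ b → a ≋ mulP (Π m) b
    factor-theorem zero    a _         = a , P.sym zero (P.*-identityˡ zero a)
    factor-theorem (suc m) (poly p) vanishes = poly fs , (begin
        poly p                                            ≈⟨ a≋X₀q ⟩
        mulP (X zero) (poly ds)
          ≈⟨ *-congˡ {X zero} (trans (A.toList-injective m ds≈Πfs) (sym (const₀-mulP (Π m) fs))) ⟩
        mulP (X zero) (mulP (const₀ (Π m)) (poly fs))     ≈⟨ sym (*-assoc (X zero) (const₀ (Π m)) (poly fs)) ⟩
        mulP (mulP (X zero) (const₀ (Π m))) (poly fs)     ≈⟨ *-congʳ (sym (Π-suc m)) ⟩
        mulP (Π (suc m)) (poly fs)                        ∎)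
      where
        open CommutativeRing (PolyRing (suc m)) using (trans; sym; +-congˡ; +-identityʳ; *-congˡ; *-congʳ; *-assoc; setoid)
        open import Relation.Binary.Reasoning.Setoid setoid
        ds : List (Poly m)
        ds = A.U.quot₁ m p
        a≋X₀q : poly p ≋ mulP (X zero) (poly ds)
        a≋X₀q = trans (proj₂ (division-by-X₀ (poly p))) (trans (+-congˡ (vanishes zero)) (+-identityʳ _))
        -- each coefficient of q vanishes on x_j = 1, hence is divisible by Π m (induction)
        coefficients-divisible : ∀ i → ∃ λ f → A.U.coeff m ds i ≋ mulP (Π m) f
        coefficients-divisible i = factor-theorem m (A.U.coeff m ds i) λ j →
          P.trans m (P.sym m (CoefficientMap.coeff-map (set1-isRingHomomorphism j) ds i))
            (A.U.get (A.toList-cong m (quotient-vanishes (poly p) (poly ds) a≋X₀q j (vanishes (suc j)))) i)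
        fs : List (Poly m)
        fs = proj₁ (A.U.common-factor m (Π m) ds coefficients-divisible)
        ds≈Πfs : A.U._≈L_ m ds (A.U.scale m (Π m) fs)
        ds≈Πfs = proj₂ (A.U.common-factor m (Π m) ds coefficients-divisible)

  constant : ∀ {m} → F.Carrier → Poly m
  constant {zero}  x = const x
  constant {suc m} x = const₀ (constant x)

  constant-isRingHomomorphism : ∀ m → IsRingHomomorphism F.rawRing (rawPoly m) constant
  constant-isRingHomomorphism zero    = ring-homomorphism (λ x≈y → mk≋ λ _ → x≈y)
    (λ _ _ → P.refl zero) (λ _ _ → P.refl zero) (λ _ → P.refl zero) (P.refl zero) (P.refl zero)
  constant-isRingHomomorphism (suc m) =
    Compose.isRingHomomorphism (P.trans (suc m)) (constant-isRingHomomorphism m) (const₀-isRingHomomorphism m)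

module QuotientRk {c ℓ} (F : Field c ℓ) (≈0? : ∀ x → Dec (Field._≈_ F x (Field.0# F))) (m k' : ℕ) where
  open Polynomials F
  open PolynomialRing F
  open IntegralDomain ≈0?
  open FactorTheorem ≈0?
  open Quotient m (suc k') using (gen; _≈R_)
  open PowersAndProducts m
  private module F = Field F
  open CommutativeRing (PolyRing m) using (trans; sym; *-congˡ; *-congʳ; *-comm)

  k : ℕ
  k = suc k'

  open PrincipalQuotient (PolyRing m) gen using (_≈Q_; R/⟨g⟩; ≈⇒≈Q; multiple≈Q0)
  R_k : CommutativeRing c (c ⊔ ℓ)
  R_k = R/⟨g⟩

  module Rk = CommutativeRing R_k
  open SquareRoots R_k using (TrivialIdempotents; complement-idempotent)
  open SquareRoots (PolyRing m) using (no-zero-divisors⇒trivial-idempotents)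

  set1-gen : ∀ j → set1 j gen ≋ zeroP
  set1-gen j = trans (prodFin-homo (λ i → powP (X i) k))
                     (prodFin-zero (λ i → set1 j (powP (X i) k)) j (trans (powP-homo (X j) k) (powP-zero k' (set1-X j))))
    where open PreservesProducts (set1-isRingHomomorphism j)

  set1-idempotent : ∀ e → mulP e e ≈Q e → ∀ j → mulP (set1 j e) (set1 j e) ≋ set1 j e
  set1-idempotent e (h , ee-e≋hgen) j = x∙y⁻¹≈ε⇒x≈y _ _ (begin
    mulP (set1 j e) (set1 j e) - set1 j e   ≈⟨ sym (+-cong (*-homo e e) (-‿homo e)) ⟩
    set1 j (mulP e e) + set1 j (- e)        ≈⟨ sym (+-homo (mulP e e) (negP e)) ⟩
    set1 j (mulP e e - e)                   ≈⟨ ⟦⟧-cong ee-e≋hgen ⟩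
    set1 j (mulP h gen)                     ≈⟨ *-homo h gen ⟩
    mulP (set1 j h) (set1 j gen)            ≈⟨ *-congˡ (set1-gen j) ⟩
    mulP (set1 j h) zeroP                   ≈⟨ zeroʳ (set1 j h) ⟩
    zeroP                                   ∎)
    where open CommutativeRing (PolyRing m) using (_+_; _-_; -_; +-cong; zeroʳ; setoid)
          open import Algebra.Properties.Ring (CommutativeRing.ring (PolyRing m)) using (x∙y⁻¹≈ε⇒x≈y)
          open IsRingHomomorphism (set1-isRingHomomorphism j)
          open import Relation.Binary.Reasoning.Setoid setoid

  idempotent-powP : ∀ e → mulP e e ≈Q e → ∀ n → powP e (suc n) ≈Q e
  idempotent-powP e ee≈e zero    = ≈⇒≈Q (CommutativeRing.*-identityʳ (PolyRing m) e)
  idempotent-powP e ee≈e (suc n) = Rk.trans (Rk.*-congˡ (idempotent-powP e ee≈e n)) ee≈e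

  -- An idempotent vanishing on all hyperplanes x_j = 1 is 0 in R_k:
  -- e = Π f gives e = e^k = Π^k f^k = gen · f^k.
  vanishing-idempotent : ∀ e → mulP e e ≈Q e → (∀ j → set1 j e ≋ zeroP) → e ≈Q zeroP
  vanishing-idempotent e ee≈e vanishes with factor-theorem m e vanishes
  ... | f , e≋Πf = Rk.trans (Rk.sym (idempotent-powP e ee≈e k')) (Rk.trans (≈⇒≈Q (begin
      powP e k                           ≈⟨ powP-cong k e≋Πf ⟩
      powP (mulP (Π m) f) k              ≈⟨ powP-mulP (Π m) f k ⟩
      mulP (powP (Π m) k) (powP f k)     ≈⟨ *-congʳ (prodFin-powP X k) ⟩
      mulP gen (powP f k)                ≈⟨ *-comm gen (powP f k) ⟩
      mulP (powP f k) gen                ∎)) (multiple≈Q0 (powP f k)))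
    where open import Relation.Binary.Reasoning.Setoid (CommutativeRing.setoid (PolyRing m))

  set1-idempotent-value : ∀ e → mulP e e ≈Q e → ∀ j → set1 j e ≋ zeroP ⊎ set1 j e ≋ oneP
  set1-idempotent-value e ee≈e j = no-zero-divisors⇒trivial-idempotents no-zero-divisors (set1 j e) (set1-idempotent e ee≈e j)

  set1-idempotent-zero : ∀ e → mulP e e ≈Q e → ε e F.≈ F.0# → ∀ j → set1 j e ≋ zeroP
  set1-idempotent-zero e ee≈e εe≈0 j with set1-idempotent-value e ee≈e j
  ... | inj₁ e₁≋0 = e₁≋0
  ... | inj₂ e₁≋1 = contradiction
      (F.trans (F.sym 1#-homo) (F.trans (⟦⟧-cong (sym e₁≋1)) (F.trans (ε-set1 j e) εe≈0))) F.1≉0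
    where open IsRingHomomorphism (ε-isRingHomomorphism m)

  set1-idempotent-one : ∀ e → mulP e e ≈Q e → ¬ (ε e F.≈ F.0#) → ∀ j → set1 j e ≋ oneP
  set1-idempotent-one e ee≈e εe≉0 j with set1-idempotent-value e ee≈e j
  ... | inj₁ e₁≋0 = contradiction (F.trans (F.sym (ε-set1 j e)) (F.trans (⟦⟧-cong e₁≋0) 0#-homo)) εe≉0
    where open IsRingHomomorphism (ε-isRingHomomorphism m)
  ... | inj₂ e₁≋1 = e₁≋1

  trivial-idempotents : TrivialIdempotents
  trivial-idempotents e ee≈e with ≈0? (ε e)
  ... | yes εe≈0 = inj₁ (vanishing-idempotent e ee≈e (set1-idempotent-zero e ee≈e εe≈0))
  ... | no εe≉0  = inj₂ (Rk.sym (x∙y⁻¹≈ε⇒x≈y oneP e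
                     (vanishing-idempotent (oneP Rk.- e) (complement-idempotent e ee≈e) complement-vanishes)))
    where
      open import Algebra.Properties.Ring Rk.ring using (x∙y⁻¹≈ε⇒x≈y)
      complement-vanishes : ∀ j → set1 j (oneP Rk.- e) ≋ zeroP
      complement-vanishes j = trans (+-homo oneP (negP e))
        (trans (P.+-cong 1#-homo (trans (-‿homo e) (P.-‿cong (set1-idempotent-one e ee≈e εe≉0 j)))) (P.-‿inverseʳ oneP))
        where open IsRingHomomorphism (set1-isRingHomomorphism j)
              module P = CommutativeRing (PolyRing m)

  ≈R⇒≈Q : ∀ {a b} → a ≈R b → a ≈Q b
  ≈R⇒≈Q (h , a-b≈hgen) = h , mk≋ a-b≈hgen

  ≈Q⇒≈R : ∀ {a b} → a ≈Q b → a ≈R b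
  ≈Q⇒≈R (h , mk≋ a-b≈hgen) = h , a-b≈hgen

  two-invertible : (∃ λ h → (F.1# F.+ F.1#) F.* h F.≈ F.1#) → ∃ λ H → mulP (addP oneP oneP) H ≈Q oneP
  two-invertible (h , 2h≈1) = constant h , ≈⇒≈Q (trans (*-congʳ (sym (trans (+-homo _ _) (P.+-cong 1#-homo 1#-homo))))
                                  (trans (sym (*-homo _ _)) (trans (⟦⟧-cong 2h≈1) 1#-homo)))
    where open IsRingHomomorphism (constant-isRingHomomorphism m)
          module P = CommutativeRing (PolyRing m)

lemma2 : ∀ {c ℓ : Level} (p m k : ℕ) → Prime p → p % 2 ≡ 1 → m ≥ 1 → k ≥ 1 →
         (F : Field c ℓ) → HasSize F (p ^ m) →
         let open Polynomials F in let open Quotient m k in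
         ∀ (u : Poly m) → IsUnit u → AtMostTwoSqrts u
lemma2 p m (suc k') _ p-odd _ (s≤s z≤n) F size u (v , uv≈1) r₁ r₂ r₃ r₁²≈u r₂²≈u r₃²≈u =
  ⊎-map ≈Q⇒≈R (⊎-map ≈Q⇒≈R ≈Q⇒≈R)
    (at-most-two-square-roots trivial-idempotents (proj₁ half-in-Rk) (proj₂ half-in-Rk) u v r₁ r₂ r₃
      (≈R⇒≈Q uv≈1) (≈R⇒≈Q r₁²≈u) (≈R⇒≈Q r₂²≈u) (≈R⇒≈Q r₃²≈u))
  where
    open FieldProperties.Finite F size using (≈-dec; half)
    open QuotientRk F (λ x → ≈-dec x (Field.0# F)) m k' using (R_k; trivial-idempotents; two-invertible; ≈R⇒≈Q; ≈Q⇒≈R)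
    open SquareRoots R_k using (at-most-two-square-roots)
    open CommutativeRing R_k using (_≈_; _+_; _*_; 1#)
    half-in-Rk : ∃ λ H → (1# + 1#) * H ≈ 1#
    half-in-Rk = two-invertible (half (Parity.odd-^ p m p-odd))
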